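{- Let $\epsilon>0$, let $w_1\le\cdots\le w_n$ be item weights in $(0,1]$ and $m$ the number of unit-capacity bins. Let $S=\{i:w_i\le\epsilon\}$, $L=\{i:w_i>\epsilon\}$, and let $L'$ be the set of the $\ell$ smallest items of $L$, with $\ell$ as large as possible subject to $\sum_{i\in L'}w_i\le m(1-\epsilon)-\sum_{i\in S}w_i$. Assume $m\epsilon$ and $k=\ell/(m\epsilon)$ are integers. Let $w_{j_1}\le\cdots\le w_{j_\ell}$ be the weights of the items of $L'$, let $L_i$ ($i=1,\ldots,k$) be the group of items with weights $w_{j_{1+(i-1)m\epsilon}},\ldots,w_{j_{im\epsilon}}$, and define rounded weights $\widetilde w$ by giving every item of $L_i$ the weight $w_{j_{im\epsilon}}$. Let $F'\subseteq L'$ be a maximum-cardinality subset of $L'$ that can be packed into the $m$ bins with respect to the weights $\widetilde w$ (each bin's total rounded weight at most $1$). Let $F$ be an optimal solution of the large-$F$ problem with the original weights, i.e. a maximum-cardinality subset of $L$ that can be packed into the $m$ bins (with respect to $w$) and satisfies $\sum_{i\in F}w_i\le m(1-\epsilon)-\sum_{i\in S}w_i$. Then $F'$ is feasible with respect to the original weights $w$ (the same packing respects all bin capacities under $w$), and $|F'|\ge|F|-\epsilon m$.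
   Context: Dual bin packing: given item weights in $(0,1]$ and $m$ bins of capacity $1$, a set of items is feasible (packable) if it can be partitioned among the $m$ bins so that the total weight in each bin is at most $1$.
   Formalization: The item weights are rational numbers in (0,1]. -}

module Defs where

open import Data.Bool using (Bool; true; false; if_then_else_; _∧_; not)
open import Data.Nat as ℕ using (ℕ; zero; suc; _∸_)
open import Data.Fin as Fin using (Fin; toℕ)
open import Data.Fin.Subset using (Subset; _∈_; _⊆_; ∣_∣)
open import Data.Vec using (lookup; tabulate)
open import Data.Integer using (+_)
open import Data.Rational as ℚ using (ℚ; 0ℚ; 1ℚ; _+_; _*_; _-_; _≤_; _<_)
open import Data.Rational.Properties using (_≤?_)
open import Relation.Nullary.Decidable using (⌊_⌋)
open import Data.Product using (Σ; ∃; _×_)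
open import Relation.Binary.PropositionalEquality using (_≡_)

ℕ→ℚ : ℕ → ℚ
ℕ→ℚ k = + k ℚ./ 1

sumℚ : ∀ {n} → (Fin n → ℚ) → ℚ
sumℚ {zero}  f = 0ℚ
sumℚ {suc n} f = f Fin.zero + sumℚ (λ i → f (Fin.suc i))

countℕ : ∀ {n} → (Fin n → Bool) → ℕ
countℕ {zero}  p = 0
countℕ {suc n} p = (if p Fin.zero then 1 else 0) ℕ.+ countℕ (λ i → p (Fin.suc i))

wsum : ∀ {n} → (Fin n → ℚ) → Subset n → ℚ
wsum w A = sumℚ (λ i → if lookup A i then w i else 0ℚ)

binLoad : ∀ {n m} → (Fin n → ℚ) → Subset n → (Fin n → Fin m) → Fin m → ℚ
binLoad w A b j = sumℚ (λ i → if lookup A i ∧ ⌊ b i Fin.≟ j ⌋ then w i else 0ℚ)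

ValidPacking : ∀ {n} (m : ℕ) → (Fin n → ℚ) → Subset n → (Fin n → Fin m) → Set
ValidPacking m w A b = ∀ (j : Fin m) → binLoad w A b j ≤ 1ℚ

Feasible : ∀ {n} (m : ℕ) → (Fin n → ℚ) → Subset n → Set
Feasible m w A = ∃ λ (b : Fin _ → Fin m) → ValidPacking m w A b

Small : ∀ {n} → (Fin n → ℚ) → ℚ → Subset n
Small w ε = tabulate (λ i → ⌊ w i ≤? ε ⌋)

Large : ∀ {n} → (Fin n → ℚ) → ℚ → Subset n
Large w ε = tabulate (λ i → not ⌊ w i ≤? ε ⌋)

bound : ∀ {n} → (Fin n → ℚ) → ℚ → ℕ → ℚ
bound w ε m = ℕ→ℚ m * (1ℚ - ε) - wsum w (Small w ε)

-- rank of i inside L (number of items of L with smaller index; ranks are 0-based)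
rankL : ∀ {n} → (Fin n → ℚ) → ℚ → Fin n → ℕ
rankL w ε i = countℕ (λ j → lookup (Large w ε) j ∧ ⌊ toℕ j ℕ.<? toℕ i ⌋)

-- the set of the t smallest items of L (w.r.t. the order w_1 ≤ ... ≤ w_n)
firstL : ∀ {n} → (Fin n → ℚ) → ℚ → ℕ → Subset n
firstL w ε t = tabulate (λ i → lookup (Large w ε) i ∧ ⌊ rankL w ε i ℕ.<? t ⌋)

IsMaxEll : ∀ {n} → (Fin n → ℚ) → ℚ → ℕ → ℕ → Set
IsMaxEll w ε m ℓ =
  (ℓ ℕ.≤ ∣ Large w ε ∣) × (wsum w (firstL w ε ℓ) ≤ bound w ε m) ×
  (∀ t → t ℕ.≤ ∣ Large w ε ∣ → wsum w (firstL w ε t) ≤ bound w ε m → t ℕ.≤ ℓ)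

-- rounded weights: with q = mε, the item of L' of (0-based) rank r lies in group
-- g = r / q (0-based), and gets the weight of the item of L of rank (g+1)q - 1,
-- i.e. w_{j_{(g+1)q}} in the paper's 1-based notation.  The latter weight is written
-- as the sum over all items of L having that rank (there is exactly one).
-- Items outside L' keep their weight (irrelevant for the statement).
rounded : ∀ {n} → (Fin n → ℚ) → ℚ → (ℓ q : ℕ) → .{{_ : ℕ.NonZero q}} → Fin n → ℚ
rounded w ε ℓ q i =
  if lookup (firstL w ε ℓ) i
  then sumℚ (λ j → if lookup (Large w ε) j
                        ∧ ⌊ rankL w ε j ℕ.≟ (suc (rankL w ε i ℕ./ q) ℕ.* q ∸ 1) ⌋
                   then w j else 0ℚ)
  else w i

-- Rounding only raises weights (an item of L′ gets the weight of the last, heaviest, item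
-- of its group), so a packing valid for the rounded weights is valid for w. For the bound,
-- let N = |F| and match the item of rank r in L with the item of rank r + d in F. With
-- d = 0 the N lightest items of L weigh at most w(F), so N ≤ ℓ by the maximality of ℓ.
-- With d = q the partner is at least as heavy as the rounded weight, since a group ends
-- before rank r + q; putting each of the N − q lightest items of L into its partner's bin
-- packs them under the rounded weights, so N − q ≤ |F′|.
module Submission where

open import Algebra using (CommutativeMonoid)
open import Data.Bool as Bool using (Bool; true; false; if_then_else_; _∧_)
open import Data.Bool.Properties using (∧-zeroʳ; ∧-identityʳ; ¬-not; if-cong)
open import Data.Empty using (⊥-elim)
open import Data.Fin as Fin using (Fin; toℕ; _≟_)
open import Data.Fin.Properties using (toℕ-injective; suc-injective)
open import Data.Fin.Subset using (Subset; _⊆_; ∣_∣)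
open import Data.Fin.Subset.Properties using (p⊆q⇒∣p∣≤∣q∣)
open import Data.Nat as ℕ using (ℕ; zero; suc; _∸_; NonZero; z≤n; s≤s; _<?_)
open import Data.Nat.DivMod using (_/_; m≡m%n+[m/n]*n; m%n<n; m/n*n≤m; m<n*o⇒m/o<n)
import Data.Nat.Properties as ℕₚ
open import Data.Product using (∃; _×_; _,_; proj₁; proj₂)
open import Data.Rational using (ℚ; 0ℚ; 1ℚ; _+_; _*_; _≤_; _<_)
import Data.Rational.Properties as ℚₚ
open import Data.Vec using ([]; _∷_; lookup)
open import Data.Vec.Functional using (updateAt)
open import Data.Vec.Functional.Properties using (updateAt-updates; updateAt-minimal)
open import Data.Vec.Properties using ([]=⇒lookup; lookup⇒[]=; lookup∘tabulate)
open import Function using (_∘_; id; const; case_of_)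
open import Relation.Nullary using (Dec; yes; no)
open import Relation.Nullary.Decidable using (⌊_⌋; dec-true; isYes≗does)
open import Relation.Binary.PropositionalEquality
open import Algebra.Properties.CommutativeSemigroup
  (CommutativeMonoid.commutativeSemigroup ℚₚ.+-0-commutativeMonoid) using (x∙yz≈y∙xz)

open import Defs

∧-true⁻ : ∀ {a b} → a ∧ b ≡ true → a ≡ true × b ≡ true
∧-true⁻ {true} b≡true = refl , b≡true

∧-true⁺ : ∀ {a b} → a ≡ true → b ≡ true → a ∧ b ≡ true
∧-true⁺ refl refl = refl

⌊⌋-true⁻ : ∀ {p} {P : Set p} (P? : Dec P) → ⌊ P? ⌋ ≡ true → P
⌊⌋-true⁻ (yes p) _ = p

⌊⌋-true⁺ : ∀ {p} {P : Set p} (P? : Dec P) → P → ⌊ P? ⌋ ≡ true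
⌊⌋-true⁺ P? p = trans (isYes≗does P?) (dec-true P? p)

⌊s<?s⌋ : ∀ a b → ⌊ suc a <? suc b ⌋ ≡ ⌊ a <? b ⌋
⌊s<?s⌋ a b = trans (isYes≗does (suc a <? suc b)) (sym (isYes≗does (a <? b)))

⊆⇒lookup : ∀ {n} {A B : Subset n} → A ⊆ B → ∀ i → lookup A i ≡ true → lookup B i ≡ true
⊆⇒lookup {A = A} {B} A⊆B i i∈A = []=⇒lookup (A⊆B (lookup⇒[]= i A i∈A))

lookup⇒⊆ : ∀ {n} {A B : Subset n} → (∀ i → lookup A i ≡ true → lookup B i ≡ true) → A ⊆ B
lookup⇒⊆ {B = B} A⊆B {i} i∈A = lookup⇒[]= i B (A⊆B i ([]=⇒lookup i∈A))

countℕ-cong : ∀ {n} {P Q : Fin n → Bool} → (∀ i → P i ≡ Q i) → countℕ P ≡ countℕ Q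
countℕ-cong {zero}  P≗Q = refl
countℕ-cong {suc n} P≗Q =
  cong₂ ℕ._+_ (if-cong (P≗Q Fin.zero)) (countℕ-cong (P≗Q ∘ Fin.suc))

countℕ-none : ∀ {n} {P : Fin n → Bool} → (∀ i → P i ≡ false) → countℕ P ≡ 0
countℕ-none {n} P≗false = trans (countℕ-cong {Q = const false} P≗false) (countℕ-false n)
  where
  countℕ-false : ∀ n → countℕ {n} (const false) ≡ 0
  countℕ-false zero    = refl
  countℕ-false (suc n) = countℕ-false n

countℕ-mono : ∀ {n} {P Q : Fin n → Bool} → (∀ i → P i ≡ true → Q i ≡ true) → countℕ P ℕ.≤ countℕ Q
countℕ-mono {zero} P⊆Q = z≤n
countℕ-mono {suc n} {P} {Q} P⊆Q with P Fin.zero in P₀ | Q Fin.zero in Q₀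
... | true  | true  = s≤s (countℕ-mono (P⊆Q ∘ Fin.suc))
... | true  | false with () ← trans (sym Q₀) (P⊆Q Fin.zero P₀)
... | false | true  = ℕₚ.m≤n⇒m≤1+n (countℕ-mono (P⊆Q ∘ Fin.suc))
... | false | false = countℕ-mono (P⊆Q ∘ Fin.suc)

countℕ-suc-true : ∀ {n} (P : Fin (suc n) → Bool) → P Fin.zero ≡ true → countℕ P ≡ suc (countℕ (P ∘ Fin.suc))
countℕ-suc-true P P₀ rewrite P₀ = refl

countℕ-suc-false : ∀ {n} (P : Fin (suc n) → Bool) → P Fin.zero ≡ false → countℕ P ≡ countℕ (P ∘ Fin.suc)
countℕ-suc-false P P₀ rewrite P₀ = refl

∣∣≡countℕ : ∀ {n} (A : Subset n) → ∣ A ∣ ≡ countℕ (lookup A)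
∣∣≡countℕ []          = refl
∣∣≡countℕ (true ∷ A)  = cong suc (∣∣≡countℕ A)
∣∣≡countℕ (false ∷ A) = ∣∣≡countℕ A

rank : ∀ {n} → (Fin n → Bool) → Fin n → ℕ
rank P i = countℕ (λ j → P j ∧ ⌊ toℕ j <? toℕ i ⌋)

rank-zero : ∀ {n} (P : Fin (suc n) → Bool) → rank P Fin.zero ≡ 0
rank-zero P = countℕ-none (λ j → ∧-zeroʳ (P j))

rank-suc : ∀ {n} (P : Fin (suc n) → Bool) (i : Fin n) →
           rank P (Fin.suc i) ≡ (if P Fin.zero then 1 else 0) ℕ.+ rank (P ∘ Fin.suc) i
rank-suc P i = cong₂ ℕ._+_ (if-cong (∧-identityʳ (P Fin.zero)))
                         (countℕ-cong (λ j → cong (P (Fin.suc j) ∧_) (⌊s<?s⌋ (toℕ j) (toℕ i))))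

rank-suc-true : ∀ {n} (P : Fin (suc n) → Bool) → P Fin.zero ≡ true → ∀ i →
                rank P (Fin.suc i) ≡ suc (rank (P ∘ Fin.suc) i)
rank-suc-true P P₀ i rewrite rank-suc P i | P₀ = refl

rank-suc-false : ∀ {n} (P : Fin (suc n) → Bool) → P Fin.zero ≡ false → ∀ i →
                 rank P (Fin.suc i) ≡ rank (P ∘ Fin.suc) i
rank-suc-false P P₀ i rewrite rank-suc P i | P₀ = refl

rank-mono : ∀ {n} {P Q : Fin n → Bool} → (∀ i → P i ≡ true → Q i ≡ true) → ∀ j → rank P j ℕ.≤ rank Q j
rank-mono {P = P} P⊆Q j = countℕ-mono λ i i∈P → let (Pi , i<j) = ∧-true⁻ {P i} i∈P in ∧-true⁺ (P⊆Q i Pi) i<j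

rank-strictMono : ∀ {n} (P : Fin n → Bool) {i j : Fin n} → P i ≡ true → toℕ i ℕ.< toℕ j → rank P i ℕ.< rank P j
rank-strictMono P {Fin.zero} {Fin.suc j} Pi _
  rewrite rank-zero P | rank-suc-true P Pi j = s≤s z≤n
rank-strictMono P {Fin.suc i} {Fin.suc j} Pi (s≤s i<j)
  rewrite rank-suc P i | rank-suc P j = ℕₚ.+-monoʳ-< _ (rank-strictMono (P ∘ Fin.suc) Pi i<j)

rank-≤⇒≤ : ∀ {n} (P : Fin n → Bool) {i j : Fin n} → P j ≡ true → rank P i ℕ.≤ rank P j → toℕ i ℕ.≤ toℕ j
rank-≤⇒≤ P Pj rank≤ = ℕₚ.≮⇒≥ (λ j<i → ℕₚ.<⇒≱ (rank-strictMono P Pj j<i) rank≤)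

rank-injective : ∀ {n} (P : Fin n → Bool) {i j : Fin n} → P i ≡ true → P j ≡ true → rank P i ≡ rank P j → i ≡ j
rank-injective P Pi Pj rank≡ = toℕ-injective
  (ℕₚ.≤-antisym (rank-≤⇒≤ P Pj (ℕₚ.≤-reflexive rank≡)) (rank-≤⇒≤ P Pi (ℕₚ.≤-reflexive (sym rank≡))))

rank-surjective : ∀ {n} (P : Fin n → Bool) {t} → t ℕ.< countℕ P → ∃ λ j → P j ≡ true × rank P j ≡ t
rank-surjective {suc n} P {t} t<count with P Fin.zero Bool.≟ true | t
... | yes P₀ | zero   = Fin.zero , P₀ , rank-zero P
... | yes P₀ | suc t′ =
  let (j , Pj , rank≡) = rank-surjective (P ∘ Fin.suc) (ℕₚ.≤-pred (subst (suc t′ ℕ.<_) (countℕ-suc-true P P₀) t<count))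
  in Fin.suc j , Pj , trans (rank-suc-true P P₀ j) (cong suc rank≡)
... | no ¬P₀ | t      =
  let P₀ = ¬-not ¬P₀
      (j , Pj , rank≡) = rank-surjective (P ∘ Fin.suc) (subst (t ℕ.<_) (countℕ-suc-false P P₀) t<count)
  in Fin.suc j , Pj , trans (rank-suc-false P P₀ j) rank≡

prefix : ∀ {n} → (Fin n → Bool) → ℕ → Fin n → Bool
prefix P t i = P i ∧ ⌊ rank P i <? t ⌋

prefix⁺ : ∀ {n} (P : Fin n → Bool) {t i} → P i ≡ true → rank P i ℕ.< t → prefix P t i ≡ true
prefix⁺ P {t} {i} Pi i<t = ∧-true⁺ Pi (⌊⌋-true⁺ (rank P i <? t) i<t)

prefix⁻ : ∀ {n} (P : Fin n → Bool) {t i} → prefix P t i ≡ true → P i ≡ true × rank P i ℕ.< t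
prefix⁻ P {t} {i} i∈prefix = let (Pi , i<t) = ∧-true⁻ {P i} i∈prefix in Pi , ⌊⌋-true⁻ (rank P i <? t) i<t

countℕ-prefix : ∀ {n} (P : Fin n → Bool) t → countℕ (prefix P t) ≡ t ℕ.⊓ countℕ P
countℕ-prefix {zero} P t = sym (ℕₚ.⊓-zeroʳ t)
countℕ-prefix {suc n} P t with P Fin.zero Bool.≟ true | t
... | yes P₀ | zero   = countℕ-none (λ i → ∧-zeroʳ (P i))
... | yes P₀ | suc t′ = begin
  countℕ (prefix P (suc t′))                    ≡⟨ countℕ-suc-true (prefix P (suc t′)) first∈prefix ⟩
  suc (countℕ (prefix P (suc t′) ∘ Fin.suc))    ≡⟨ cong suc (countℕ-cong shift) ⟩
  suc (countℕ (prefix (P ∘ Fin.suc) t′))        ≡⟨ cong suc (countℕ-prefix (P ∘ Fin.suc) t′) ⟩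
  suc (t′ ℕ.⊓ countℕ (P ∘ Fin.suc))             ≡⟨ cong (suc t′ ℕ.⊓_) (countℕ-suc-true P P₀) ⟨
  suc t′ ℕ.⊓ countℕ P                           ∎
  where
  open ≡-Reasoning
  first∈prefix : prefix P (suc t′) Fin.zero ≡ true
  first∈prefix = prefix⁺ P P₀ (subst (ℕ._< suc t′) (sym (rank-zero P)) (s≤s z≤n))
  shift : ∀ i → prefix P (suc t′) (Fin.suc i) ≡ prefix (P ∘ Fin.suc) t′ i
  shift i = trans (cong (λ r → P (Fin.suc i) ∧ ⌊ r <? suc t′ ⌋) (rank-suc-true P P₀ i))
                  (cong (P (Fin.suc i) ∧_) (⌊s<?s⌋ (rank (P ∘ Fin.suc) i) t′))
... | no ¬P₀ | t      = begin
  countℕ (prefix P t)                    ≡⟨ countℕ-suc-false (prefix P t) (cong (_∧ ⌊ rank P Fin.zero <? t ⌋) P₀) ⟩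
  countℕ (prefix P t ∘ Fin.suc)          ≡⟨ countℕ-cong (λ i → cong (λ r → P (Fin.suc i) ∧ ⌊ r <? t ⌋) (rank-suc-false P P₀ i)) ⟩
  countℕ (prefix (P ∘ Fin.suc) t)        ≡⟨ countℕ-prefix (P ∘ Fin.suc) t ⟩
  t ℕ.⊓ countℕ (P ∘ Fin.suc)             ≡⟨ cong (t ℕ.⊓_) (countℕ-suc-false P P₀) ⟨
  t ℕ.⊓ countℕ P                         ∎
  where
  open ≡-Reasoning
  P₀ = ¬-not ¬P₀

-- Junk value i when Q has no member of rank rank P i + d.
shiftInto : ∀ {n} (P Q : Fin n → Bool) (d : ℕ) → Fin n → Fin n
shiftInto P Q d i with rank P i ℕ.+ d <? countℕ Q
... | yes r<count = proj₁ (rank-surjective Q r<count)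
... | no _        = i

shiftInto-spec : ∀ {n} (P Q : Fin n → Bool) d {i} → rank P i ℕ.+ d ℕ.< countℕ Q →
                 Q (shiftInto P Q d i) ≡ true × rank Q (shiftInto P Q d i) ≡ rank P i ℕ.+ d
shiftInto-spec P Q d {i} r<count with rank P i ℕ.+ d <? countℕ Q
... | yes r<count′ = proj₂ (rank-surjective Q r<count′)
... | no r≮count   = ⊥-elim (r≮count r<count)

sumℚ-nonneg : ∀ {n} {f : Fin n → ℚ} → (∀ i → 0ℚ ≤ f i) → 0ℚ ≤ sumℚ f
sumℚ-nonneg {zero}  _   = ℚₚ.≤-refl
sumℚ-nonneg {suc n} f≥0 = ℚₚ.+-mono-≤ (f≥0 Fin.zero) (sumℚ-nonneg (f≥0 ∘ Fin.suc))

sumℚ-zero : ∀ {n} {f : Fin n → ℚ} → (∀ i → f i ≡ 0ℚ) → sumℚ f ≡ 0ℚ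
sumℚ-zero {zero}  _   = refl
sumℚ-zero {suc n} f≡0 = cong₂ _+_ (f≡0 Fin.zero) (sumℚ-zero (f≡0 ∘ Fin.suc))

sumℚ-updateAt : ∀ {n} (f : Fin n → ℚ) k → sumℚ f ≡ f k + sumℚ (updateAt f k (const 0ℚ))
sumℚ-updateAt f Fin.zero    = cong (f Fin.zero +_) (sym (ℚₚ.+-identityˡ _))
sumℚ-updateAt f (Fin.suc k) = begin
  f Fin.zero + sumℚ (f ∘ Fin.suc)                         ≡⟨ cong (f Fin.zero +_) (sumℚ-updateAt (f ∘ Fin.suc) k) ⟩
  f Fin.zero + (f (Fin.suc k) + sumℚ (updateAt (f ∘ Fin.suc) k (const 0ℚ)))
                                                           ≡⟨ x∙yz≈y∙xz (f Fin.zero) (f (Fin.suc k)) _ ⟩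
  f (Fin.suc k) + (f Fin.zero + sumℚ (updateAt (f ∘ Fin.suc) k (const 0ℚ)))  ∎
  where open ≡-Reasoning

sumℚ-single : ∀ {n} (S : Fin n → Bool) (f : Fin n → ℚ) {x} → S x ≡ true → (∀ j → S j ≡ true → j ≡ x) →
              sumℚ (λ j → if S j then f j else 0ℚ) ≡ f x
sumℚ-single {suc n} S f {Fin.zero} Sx only-x rewrite Sx =
  trans (cong (f Fin.zero +_) (sumℚ-zero rest≡0)) (ℚₚ.+-identityʳ (f Fin.zero))
  where
  rest≡0 : ∀ j → (if S (Fin.suc j) then f (Fin.suc j) else 0ℚ) ≡ 0ℚ
  rest≡0 j with S (Fin.suc j) in Sj
  ... | true with () ← only-x (Fin.suc j) Sj
  ... | false = refl
sumℚ-single {suc n} S f {Fin.suc x} Sx only-x with S Fin.zero in S₀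
... | true with () ← only-x Fin.zero S₀
... | false = trans (ℚₚ.+-identityˡ _)
  (sumℚ-single (S ∘ Fin.suc) (f ∘ Fin.suc) Sx (λ j Sj → suc-injective (only-x (Fin.suc j) Sj)))

sumℚ-≤-injection : ∀ {n m} (S : Fin n → Bool) (a : Fin n → ℚ) (b : Fin m → ℚ) (σ : Fin n → Fin m) →
  (∀ j → 0ℚ ≤ b j) → (∀ i → S i ≡ true → a i ≤ b (σ i)) →
  (∀ i j → S i ≡ true → S j ≡ true → σ i ≡ σ j → i ≡ j) →
  sumℚ (λ i → if S i then a i else 0ℚ) ≤ sumℚ b
sumℚ-≤-injection {zero} S a b σ b≥0 a≤bσ σ-inj = sumℚ-nonneg b≥0
sumℚ-≤-injection {suc n} S a b σ b≥0 a≤bσ σ-inj with S Fin.zero in S₀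
... | false = subst (_≤ sumℚ b) (sym (ℚₚ.+-identityˡ _))
  (sumℚ-≤-injection (S ∘ Fin.suc) (a ∘ Fin.suc) b (σ ∘ Fin.suc) b≥0 (a≤bσ ∘ Fin.suc)
    (λ i j Si Sj σi≡σj → suc-injective (σ-inj (Fin.suc i) (Fin.suc j) Si Sj σi≡σj)))
... | true = begin
  a Fin.zero + sumℚ (λ i → if S (Fin.suc i) then a (Fin.suc i) else 0ℚ)
    ≤⟨ ℚₚ.+-mono-≤ (a≤bσ Fin.zero S₀)
         (sumℚ-≤-injection (S ∘ Fin.suc) (a ∘ Fin.suc) b′ (σ ∘ Fin.suc) b′≥0 a≤b′σ
            (λ i j Si Sj σi≡σj → suc-injective (σ-inj (Fin.suc i) (Fin.suc j) Si Sj σi≡σj))) ⟩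
  b (σ Fin.zero) + sumℚ b′  ≡⟨ sumℚ-updateAt b (σ Fin.zero) ⟨
  sumℚ b                    ∎
  where
  open ℚₚ.≤-Reasoning
  b′ : Fin _ → ℚ
  b′ = updateAt b (σ Fin.zero) (const 0ℚ)
  b′≥0 : ∀ j → 0ℚ ≤ b′ j
  b′≥0 j with j ≟ σ Fin.zero
  ... | yes refl = subst (0ℚ ≤_) (sym (updateAt-updates j b)) ℚₚ.≤-refl
  ... | no j≢σ₀  = subst (0ℚ ≤_) (sym (updateAt-minimal j (σ Fin.zero) b j≢σ₀)) (b≥0 j)
  a≤b′σ : ∀ i → S (Fin.suc i) ≡ true → a (Fin.suc i) ≤ b′ (σ (Fin.suc i))
  a≤b′σ i Si = subst (a (Fin.suc i) ≤_) (sym (updateAt-minimal _ _ b σi≢σ₀)) (a≤bσ (Fin.suc i) Si)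
    where σi≢σ₀ = λ σi≡σ₀ → case σ-inj (Fin.suc i) Fin.zero Si S₀ σi≡σ₀ of λ ()

record WeightDomination {n} (w′ : Fin n → ℚ) (A : Subset n) (w : Fin n → ℚ) (B : Subset n)
                        (σ : Fin n → Fin n) : Set where
  field
    maps-into : ∀ i → lookup A i ≡ true → lookup B (σ i) ≡ true
    lighter   : ∀ i → lookup A i ≡ true → w′ i ≤ w (σ i)
    injective : ∀ i j → lookup A i ≡ true → lookup A j ≡ true → σ i ≡ σ j → i ≡ j

domination-id : ∀ {n} {w′ w : Fin n → ℚ} {A : Subset n} → (∀ i → lookup A i ≡ true → w′ i ≤ w i) →
                WeightDomination w′ A w A id
domination-id w′≤w = record { maps-into = λ _ i∈A → i∈A ; lighter = w′≤w ; injective = λ _ _ _ _ i≡j → i≡j }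

if-nonneg : ∀ (c : Bool) {x} → (c ≡ true → 0ℚ ≤ x) → 0ℚ ≤ (if c then x else 0ℚ)
if-nonneg true  x≥0 = x≥0 refl
if-nonneg false _   = ℚₚ.≤-refl

module _ {n} {w′ w : Fin n → ℚ} {A B : Subset n} {σ : Fin n → Fin n}
         (w≥0 : ∀ i → lookup B i ≡ true → 0ℚ ≤ w i) (dom : WeightDomination w′ A w B σ) where
  open WeightDomination dom

  wsum-≤-domination : wsum w′ A ≤ wsum w B
  wsum-≤-domination =
    sumℚ-≤-injection (lookup A) w′ _ σ (λ i → if-nonneg (lookup B i) (w≥0 i)) lighter′ injective
    where
    lighter′ : ∀ i → lookup A i ≡ true → w′ i ≤ (if lookup B (σ i) then w (σ i) else 0ℚ)
    lighter′ i i∈A rewrite maps-into i i∈A = lighter i i∈A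

  validPacking-domination : ∀ {m} (b : Fin n → Fin m) → ValidPacking m w B b → ValidPacking m w′ A (b ∘ σ)
  validPacking-domination b valid j = ℚₚ.≤-trans load≤ (valid j)
    where
    S = λ i → lookup A i ∧ ⌊ b (σ i) ≟ j ⌋
    in-bin : ∀ i → S i ≡ true → lookup B (σ i) ∧ ⌊ b (σ i) ≟ j ⌋ ≡ true
    in-bin i Si = let (i∈A , σi∈j) = ∧-true⁻ {lookup A i} Si in ∧-true⁺ (maps-into i i∈A) σi∈j
    lighter′ : ∀ i → S i ≡ true → w′ i ≤ (if lookup B (σ i) ∧ ⌊ b (σ i) ≟ j ⌋ then w (σ i) else 0ℚ)
    lighter′ i Si rewrite in-bin i Si = lighter i (proj₁ (∧-true⁻ {lookup A i} Si))
    load≤ : binLoad w′ A (b ∘ σ) j ≤ binLoad w B b j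
    load≤ = sumℚ-≤-injection S w′ _ σ
      (λ i → if-nonneg (lookup B i ∧ _) (w≥0 i ∘ proj₁ ∘ ∧-true⁻ {lookup B i})) lighter′
      (λ i i′ Si Si′ → injective i i′ (proj₁ (∧-true⁻ {lookup A i} Si)) (proj₁ (∧-true⁻ {lookup A i′} Si′)))

<∸⇒+< : ∀ {m n d} → m ℕ.< n ∸ d → m ℕ.+ d ℕ.< n
<∸⇒+< {m} {n} {d} m<n∸d = ℕₚ.m≤o∸n⇒m+n≤o (suc m) d≤n m<n∸d
  where d≤n = ℕₚ.<⇒≤ (ℕₚ.m∸n≢0⇒n<m (λ n∸d≡0 → ℕₚ.n≮0 (subst (m ℕ.<_) n∸d≡0 m<n∸d)))

groupEnd : (q r : ℕ) .{{_ : NonZero q}} → ℕ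
groupEnd q r = suc (r / q) ℕ.* q ∸ 1

≤-groupEnd : ∀ q r .{{_ : NonZero q}} → r ℕ.≤ groupEnd q r
≤-groupEnd (suc q′) r = subst (ℕ._≤ q′ ℕ.+ r / q ℕ.* q) (sym (m≡m%n+[m/n]*n r q))
                              (ℕₚ.+-monoˡ-≤ (r / q ℕ.* q) (ℕₚ.≤-pred (m%n<n r q)))
  where q = suc q′

groupEnd-< : ∀ q r .{{_ : NonZero q}} → groupEnd q r ℕ.< r ℕ.+ q
groupEnd-< (suc q′) r = subst (q′ ℕ.+ r / q ℕ.* q ℕ.<_) (ℕₚ.+-comm q r)
                              (ℕₚ.+-mono-<-≤ (ℕₚ.n<1+n q′) (m/n*n≤m r q))
  where q = suc q′

groupEnd-<-* : ∀ q r k .{{_ : NonZero q}} → r ℕ.< k ℕ.* q → groupEnd q r ℕ.< k ℕ.* q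
groupEnd-<-* (suc q′) r k r<kq = ℕₚ.*-monoˡ-≤ (suc q′) (m<n*o⇒m/o<n {r} {k} r<kq)

module _ {n} (w : Fin n → ℚ) (ε : ℚ) where

  private
    L : Fin n → Bool
    L = lookup (Large w ε)

  lookup-firstL : ∀ t i → lookup (firstL w ε t) i ≡ prefix L t i
  lookup-firstL t = lookup∘tabulate (prefix L t)

  firstL⁻ : ∀ {t i} → lookup (firstL w ε t) i ≡ true → L i ≡ true × rank L i ℕ.< t
  firstL⁻ {t} {i} i∈firstL = prefix⁻ L (trans (sym (lookup-firstL t i)) i∈firstL)

  firstL-mono : ∀ {s t} → s ℕ.≤ t → firstL w ε s ⊆ firstL w ε t
  firstL-mono {s} {t} s≤t = lookup⇒⊆ λ i i∈firstL →
    let (Li , i<s) = firstL⁻ i∈firstL in trans (lookup-firstL t i) (prefix⁺ L Li (ℕₚ.<-≤-trans i<s s≤t))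

  ∣firstL∣ : ∀ t → ∣ firstL w ε t ∣ ≡ t ℕ.⊓ ∣ Large w ε ∣
  ∣firstL∣ t = begin
    ∣ firstL w ε t ∣               ≡⟨ ∣∣≡countℕ (firstL w ε t) ⟩
    countℕ (lookup (firstL w ε t))  ≡⟨ countℕ-cong (lookup-firstL t) ⟩
    countℕ (prefix L t)             ≡⟨ countℕ-prefix L t ⟩
    t ℕ.⊓ countℕ L                  ≡⟨ cong (t ℕ.⊓_) (∣∣≡countℕ (Large w ε)) ⟨
    t ℕ.⊓ ∣ Large w ε ∣             ∎
    where open ≡-Reasoning

  rounded-weight : ∀ ℓ q k .{{_ : NonZero q}} → ℓ ≡ k ℕ.* q → ℓ ℕ.≤ ∣ Large w ε ∣ →
                   ∀ {i} → lookup (firstL w ε ℓ) i ≡ true →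
                   ∃ λ x → L x ≡ true × rank L x ≡ groupEnd q (rank L i) × rounded w ε ℓ q i ≡ w x
  rounded-weight ℓ q k ℓ≡kq ℓ≤∣L∣ {i} i∈L′ = x , Lx , rank-x , rounded≡wx
    where
    end<ℓ : groupEnd q (rank L i) ℕ.< ℓ
    end<ℓ = subst (groupEnd q (rank L i) ℕ.<_) (sym ℓ≡kq)
                  (groupEnd-<-* q (rank L i) k (subst (rank L i ℕ.<_) ℓ≡kq (proj₂ (firstL⁻ i∈L′))))
    x-spec = rank-surjective L (ℕₚ.<-≤-trans end<ℓ (subst (ℓ ℕ.≤_) (∣∣≡countℕ (Large w ε)) ℓ≤∣L∣))
    x = proj₁ x-spec
    Lx = proj₁ (proj₂ x-spec)
    rank-x = proj₂ (proj₂ x-spec)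
    S : Fin n → Bool
    S j = L j ∧ ⌊ rank L j ℕ.≟ groupEnd q (rank L i) ⌋
    only-x : ∀ j → S j ≡ true → j ≡ x
    only-x j Sj = let (Lj , rank-j) = ∧-true⁻ {L j} Sj in
      rank-injective L Lj Lx (trans (⌊⌋-true⁻ (rank L j ℕ.≟ _) rank-j) (sym rank-x))
    rounded≡wx : rounded w ε ℓ q i ≡ w x
    rounded≡wx = trans (if-cong i∈L′) (sumℚ-single S w (∧-true⁺ Lx (⌊⌋-true⁺ (rank L x ℕ.≟ _) rank-x)) only-x)

  firstL-domination : ∀ (F : Subset n) → F ⊆ Large w ε → ∀ d (w′ : Fin n → ℚ) →
    (∀ {i y} → lookup (firstL w ε (∣ F ∣ ∸ d)) i ≡ true → L y ≡ true → rank L i ℕ.+ d ℕ.≤ rank L y → w′ i ≤ w y) →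
    WeightDomination w′ (firstL w ε (∣ F ∣ ∸ d)) w F (shiftInto L (lookup F) d)
  firstL-domination F F⊆L d w′ w′≤w = record
    { maps-into = λ i i∈G → proj₁ (spec i∈G)
    ; lighter   = λ i i∈G → w′≤w i∈G (⊆⇒lookup F⊆L _ (proj₁ (spec i∈G))) (shifted-rank i∈G)
    ; injective = λ i j i∈G j∈G σi≡σj → rank-injective L (proj₁ (firstL⁻ i∈G)) (proj₁ (firstL⁻ j∈G))
        (ℕₚ.+-cancelʳ-≡ d _ _ (trans (sym (proj₂ (spec i∈G))) (trans (cong (rank (lookup F)) σi≡σj) (proj₂ (spec j∈G)))))
    }
    where
    σ = shiftInto L (lookup F) d
    spec : ∀ {i} → lookup (firstL w ε (∣ F ∣ ∸ d)) i ≡ true →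
           lookup F (σ i) ≡ true × rank (lookup F) (σ i) ≡ rank L i ℕ.+ d
    spec {i} i∈G = shiftInto-spec L (lookup F) d (subst (rank L i ℕ.+ d ℕ.<_) (∣∣≡countℕ F) (<∸⇒+< (proj₂ (firstL⁻ i∈G))))
    shifted-rank : ∀ {i} → lookup (firstL w ε (∣ F ∣ ∸ d)) i ≡ true → rank L i ℕ.+ d ℕ.≤ rank L (σ i)
    shifted-rank {i} i∈G = subst (ℕ._≤ rank L (σ i)) (proj₂ (spec i∈G)) (rank-mono (⊆⇒lookup F⊆L) (σ i))

  module _ (w-mono : ∀ i j → i Fin.≤ j → w i ≤ w j) (w≥0 : ∀ i → 0ℚ ≤ w i) where

    ≤-by-rank : ∀ {i y} → L y ≡ true → rank L i ℕ.≤ rank L y → w i ≤ w y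
    ≤-by-rank Ly rank≤ = w-mono _ _ (rank-≤⇒≤ L Ly rank≤)

    firstL-lightest : ∀ (F : Subset n) → F ⊆ Large w ε → wsum w (firstL w ε ∣ F ∣) ≤ wsum w F
    firstL-lightest F F⊆L = wsum-≤-domination (λ i _ → w≥0 i)
      (firstL-domination F F⊆L 0 w λ {i} _ Ly rank≤ → ≤-by-rank Ly (subst (ℕ._≤ _) (ℕₚ.+-identityʳ (rank L i)) rank≤))

    module _ {ℓ q} (k : ℕ) .{{_ : NonZero q}} (ℓ≡kq : ℓ ≡ k ℕ.* q) (ℓ≤∣L∣ : ℓ ℕ.≤ ∣ Large w ε ∣) where

      ≤-rounded : ∀ {i} → lookup (firstL w ε ℓ) i ≡ true → w i ≤ rounded w ε ℓ q i
      ≤-rounded {i} i∈L′ =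
        let (x , Lx , rank-x , rounded≡wx) = rounded-weight ℓ q k ℓ≡kq ℓ≤∣L∣ i∈L′
        in subst (w i ≤_) (sym rounded≡wx) (≤-by-rank Lx (subst (rank L i ℕ.≤_) (sym rank-x) (≤-groupEnd q (rank L i))))

      rounded-≤ : ∀ {i y} → lookup (firstL w ε ℓ) i ≡ true → L y ≡ true → rank L i ℕ.+ q ℕ.≤ rank L y →
                  rounded w ε ℓ q i ≤ w y
      rounded-≤ {i} i∈L′ Ly rank≤ =
        let (x , Lx , rank-x , rounded≡wx) = rounded-weight ℓ q k ℓ≡kq ℓ≤∣L∣ i∈L′
        in subst (_≤ _) (sym rounded≡wx)
             (≤-by-rank Ly (ℕₚ.<⇒≤ (subst (ℕ._< _) (sym rank-x) (ℕₚ.<-≤-trans (groupEnd-< q (rank L i)) rank≤))))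

      validPacking-unrounded : ∀ {m F′} → F′ ⊆ firstL w ε ℓ → (b : Fin n → Fin m) →
                               ValidPacking m (rounded w ε ℓ q) F′ b → ValidPacking m w F′ b
      validPacking-unrounded {F′ = F′} F′⊆L′ = validPacking-domination
        (λ i i∈F′ → ℚₚ.≤-trans (w≥0 i) (≤-rounded (⊆⇒lookup F′⊆L′ i i∈F′)))
        (domination-id {A = F′} λ i i∈F′ → ≤-rounded (⊆⇒lookup F′⊆L′ i i∈F′))

      firstL-roundedPacking : ∀ {m} (F : Subset n) → F ⊆ Large w ε → ∣ F ∣ ℕ.≤ ℓ →
        (b : Fin n → Fin m) → ValidPacking m w F b →
        ValidPacking m (rounded w ε ℓ q) (firstL w ε (∣ F ∣ ∸ q)) (b ∘ shiftInto L (lookup F) q)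
      firstL-roundedPacking F F⊆L ∣F∣≤ℓ = validPacking-domination (λ i _ → w≥0 i)
        (firstL-domination F F⊆L q (rounded w ε ℓ q) λ i∈G → rounded-≤ (⊆⇒lookup G⊆L′ _ i∈G))
        where G⊆L′ = firstL-mono (ℕₚ.≤-trans (ℕₚ.m∸n≤m ∣ F ∣ q) ∣F∣≤ℓ)

mainTheorem7 :
  ∀ {n : ℕ} (m : ℕ) (ε : ℚ) (w : Fin n → ℚ) →
  0ℚ < ε →
  (∀ i → 0ℚ < w i × w i ≤ 1ℚ) →
  (∀ i j → i Fin.≤ j → w i ≤ w j) →
  (q : ℕ) → .{{_ : NonZero q}} → ℕ→ℚ m * ε ≡ ℕ→ℚ q →
  (ℓ : ℕ) → IsMaxEll w ε m ℓ →
  (k : ℕ) → ℓ ≡ k ℕ.* q →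
  (F' : Subset n) → F' ⊆ firstL w ε ℓ → Feasible m (rounded w ε ℓ q) F' →
  (∀ G → G ⊆ firstL w ε ℓ → Feasible m (rounded w ε ℓ q) G → ∣ G ∣ ℕ.≤ ∣ F' ∣) →
  (F : Subset n) → F ⊆ Large w ε → Feasible m w F → wsum w F ≤ bound w ε m →
  (∀ G → G ⊆ Large w ε → Feasible m w G → wsum w G ≤ bound w ε m → ∣ G ∣ ℕ.≤ ∣ F ∣) →
  Feasible m w F' ×
  (∀ (b : Fin n → Fin m) → ValidPacking m (rounded w ε ℓ q) F' b → ValidPacking m w F' b)
  × (∣ F ∣ ℕ.≤ ∣ F' ∣ ℕ.+ q)
mainTheorem7 m ε w _ w∈⟨0,1] w-mono q _ ℓ (ℓ≤∣L∣ , _ , ℓ-maximal) k ℓ≡kq F′ F′⊆L′ (b , b-valid) F′-maximum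
             F F⊆L (bF , bF-valid) wF≤bound _ =
  (b , unround b b-valid) , unround , ∣F∣≤∣F′∣+q
  where
  w≥0 : ∀ i → 0ℚ ≤ w i
  w≥0 i = ℚₚ.<⇒≤ (proj₁ (w∈⟨0,1] i))
  unround : ∀ b → ValidPacking m (rounded w ε ℓ q) F′ b → ValidPacking m w F′ b
  unround = validPacking-unrounded w ε w-mono w≥0 k ℓ≡kq ℓ≤∣L∣ F′⊆L′
  ∣F∣≤ℓ : ∣ F ∣ ℕ.≤ ℓ
  ∣F∣≤ℓ = ℓ-maximal ∣ F ∣ (p⊆q⇒∣p∣≤∣q∣ F⊆L) (ℚₚ.≤-trans (firstL-lightest w ε w-mono w≥0 F F⊆L) wF≤bound)
  G = firstL w ε (∣ F ∣ ∸ q)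
  ∣G∣≡∣F∣∸q : ∣ G ∣ ≡ ∣ F ∣ ∸ q
  ∣G∣≡∣F∣∸q = trans (∣firstL∣ w ε _) (ℕₚ.m≤n⇒m⊓n≡m (ℕₚ.≤-trans (ℕₚ.m∸n≤m ∣ F ∣ q) (ℕₚ.≤-trans ∣F∣≤ℓ ℓ≤∣L∣)))
  ∣G∣≤∣F′∣ : ∣ G ∣ ℕ.≤ ∣ F′ ∣
  ∣G∣≤∣F′∣ = F′-maximum G (firstL-mono w ε (ℕₚ.≤-trans (ℕₚ.m∸n≤m ∣ F ∣ q) ∣F∣≤ℓ))
               (_ , firstL-roundedPacking w ε w-mono w≥0 k ℓ≡kq ℓ≤∣L∣ F F⊆L ∣F∣≤ℓ bF bF-valid)
  ∣F∣≤∣F′∣+q : ∣ F ∣ ℕ.≤ ∣ F′ ∣ ℕ.+ q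
  ∣F∣≤∣F′∣+q = begin
    ∣ F ∣              ≤⟨ ℕₚ.m≤n+m∸n ∣ F ∣ q ⟩
    q ℕ.+ (∣ F ∣ ∸ q)  ≡⟨ cong (q ℕ.+_) ∣G∣≡∣F∣∸q ⟨
    q ℕ.+ ∣ G ∣        ≤⟨ ℕₚ.+-monoʳ-≤ q ∣G∣≤∣F′∣ ⟩
    q ℕ.+ ∣ F′ ∣       ≡⟨ ℕₚ.+-comm q ∣ F′ ∣ ⟩
    ∣ F′ ∣ ℕ.+ q       ∎
    where open ℕₚ.≤-Reasoning
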